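{- For every permutation $\sigma\in\Sigma_3$ the permutation density $d_3(\sigma)$ exists, and \[ d_3(1,2,3)=\tfrac14,\quad d_3(1,3,2)=\tfrac18,\quad d_3(2,1,3)=\tfrac18,\quad d_3(2,3,1)=\tfrac18,\quad d_3(3,1,2)=\tfrac18,\quad d_3(3,2,1)=\tfrac14 . \]
   Context: Let $\Omega$ be the set of odd positive integers. The Syracuse function $S:\Omega\to\Omega$ is defined by $S(m)=(3m+1)/2^e$, where $e$ is the largest integer with $2^e\mid 3m+1$ (i.e. $S(m)$ is the largest odd divisor of $3m+1$); $S^j$ denotes the $j$th iterate. Let $\Sigma_n$ be the group of permutations of $\{1,\dots,n\}$. For an $n$-tuple $X=(x_1,\dots,x_n)$ of distinct real numbers, let $y_1<\dots<y_n$ be its coordinates in increasing order; the permutation pattern of $X$ is the unique $\sigma\in\Sigma_n$ with $x_i=y_{\sigma(i)}$ for all $i$, written $(\sigma(1),\dots,\sigma(n))$. For $\sigma\in\Sigma_n$, let $\Gamma_\sigma(M)$ be the number of $m\in\Omega$ with $m\le M$ such that the $n$-tuple $(m,S(m),\dots,S^{n-1}(m))$ has distinct coordinates and permutation pattern $\sigma$. The permutation density of $\sigma$ is $d_n(\sigma)=\lim_{M\to\infty}\Gamma_\sigma(M)/(M/2)$, when the limit exists. -}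

module Defs where

open import Data.Bool using (Bool; true; false; _∧_; not; if_then_else_)
open import Data.Nat using (ℕ; zero; suc; _+_; _*_; _≤_; _<ᵇ_; _≡ᵇ_)
open import Data.Nat.DivMod using (_/_; _%_)
open import Data.Fin using (Fin; toℕ)
open import Data.Vec using (Vec; tabulate; lookup; _∷_; [])
open import Data.Integer using (+_)
open import Data.Rational using (ℚ; 0ℚ; ∣_∣; _-_; _<_)
import Data.Rational as ℚ
open import Data.Product using (∃-syntax)

-- odd part of n (n with all factors 2 removed), using fuel; fuel n suffices
-- for n ≥ 1 since at most log₂ n halvings are performed.
oddPartF : ℕ → ℕ → ℕ
oddPartF zero    n = n
oddPartF (suc f) n = if (n % 2 ≡ᵇ 0) ∧ not (n ≡ᵇ 0) then oddPartF f (n / 2) else n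

oddPart : ℕ → ℕ
oddPart n = oddPartF n n

S : ℕ → ℕ
S m = oddPart (3 * m + 1)

iter : ℕ → ℕ → ℕ
iter zero    m = m
iter (suc j) m = S (iter j m)

orbit : (n : ℕ) → ℕ → Vec ℕ n
orbit n m = tabulate (λ i → iter (toℕ i) m)

allFin : (n : ℕ) → (Fin n → Bool) → Bool
allFin zero    p = true
allFin (suc n) p = p Fin.zero ∧ allFin n (λ i → p (Fin.suc i))
  where import Data.Fin as Fin

countFin : (n : ℕ) → (Fin n → Bool) → ℕ
countFin zero    p = 0
countFin (suc n) p = (if p Fin.zero then 1 else 0) + countFin n (λ i → p (Fin.suc i))
  where import Data.Fin as Fin

distinct : {n : ℕ} → Vec ℕ n → Bool
distinct {n} x = allFin n (λ i → allFin n (λ j →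
  (toℕ i ≡ᵇ toℕ j) ∨' not (lookup x i ≡ᵇ lookup x j)))
  where
  _∨'_ : Bool → Bool → Bool
  true  ∨' _ = true
  false ∨' b = b

rank : {n : ℕ} → Vec ℕ n → Fin n → ℕ
rank {n} x i = suc (countFin n (λ j → lookup x j <ᵇ lookup x i))

-- X has distinct coordinates and permutation pattern σ, i.e. x_i = y_{σ(i)}
-- where y_1 < … < y_n are the sorted coordinates; σ given as (σ(1),…,σ(n)).
hasPattern : {n : ℕ} → Vec ℕ n → Vec ℕ n → Bool
hasPattern {n} x σ = distinct x ∧ allFin n (λ i → rank x i ≡ᵇ lookup σ i)

isOdd : ℕ → Bool
isOdd m = m % 2 ≡ᵇ 1

Γ : {n : ℕ} → Vec ℕ n → ℕ → ℕ
Γ σ zero    = 0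
Γ {n} σ (suc M) = (if isOdd (suc M) ∧ hasPattern (orbit n (suc M)) σ then 1 else 0) + Γ σ M

-- the ratio Γ_σ(M) / (M/2) = 2 Γ_σ(M) / M  (set to 0 at M = 0)
ratio : {n : ℕ} → Vec ℕ n → ℕ → ℚ
ratio σ zero    = 0ℚ
ratio σ (suc M) = (+ (2 * Γ σ (suc M))) ℚ./ suc M

_⟶_ : (ℕ → ℚ) → ℚ → Set
f ⟶ c = ∀ (ε : ℚ) → 0ℚ < ε → ∃[ N ] (∀ M → N ≤ M → ∣ f M - c ∣ < ε)

densityIs : {n : ℕ} → Vec ℕ n → ℚ → Set
densityIs σ c = ratio σ ⟶ c

-- Split the odd m by their residue r mod 16. On each class S and S² are affine in m (up to odd
-- parts), so for r = 1, 3, 7, 9, 11, 15 the pattern of (m, S m, S² m) depends only on r (save m = 1),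
-- and each class has density 1/8 among odd numbers. For r = 5, 13 one has S m < m/2 and the pattern
-- is (3,1,2) or (3,2,1) according as S m ≡ 3 or 1 (mod 4), where S m runs through 5 + 6t,
-- resp. oddPart (1 + 3t). The residues of 5 + 6t alternate; for oddPart (1 + 3t), splitting t by
-- parity expresses the sums over it and over oddPart (2 + 3t) by each other at half the length, so
-- the excess of one residue over the other is O(log T). A density a/b is obtained by showing
-- 2b·Γ(M) − a·M = o(M).
module Submission where

open import Data.Bool using (Bool; true; false; T; _∧_; _∨_; not; if_then_else_)
open import Data.Nat as ℕ
  using (ℕ; zero; suc; _+_; _*_; _^_; _≤_; _<_; z≤n; s≤s; _≡ᵇ_; _<ᵇ_; ⌊_/2⌋)
import Data.Nat.Properties as ℕ
open import Data.Nat.Coprimality using (Coprime)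
open import Data.Nat.DivMod using (_/_; _%_; m≡m%n+[m/n]*n; [m+kn]%n≡m%n; m*n/n≡m; m%n<n; m/n<m; m/n≤m)
open import Data.Nat.Induction using (<-rec)
open import Data.Nat.Tactic.RingSolver using (solve-∀)
open import Data.Integer as ℤ using (ℤ; +_; +[1+_]; -[1+_]; ∣_∣)
import Data.Integer.Properties as ℤ
import Data.Integer.Tactic.RingSolver as ℤ-Ring
open import Data.Rational as ℚ using (mkℚ; toℚᵘ)
import Data.Rational.Properties as ℚ
import Data.Rational.Unnormalised as ℚᵘ
import Data.Rational.Unnormalised.Properties as ℚᵘ
open import Data.Vec using (Vec; _∷_; []; map; lookup)
open import Data.Vec.Properties using (lookup-map)
open import Data.Fin as Fin using (Fin)
open import Data.Bool.Properties using (∧-zeroʳ; ∧-identityʳ; ∨-identityʳ)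
open import Data.Empty using (⊥-elim)
open import Relation.Nullary using (yes; no; contradiction)
open import Data.Product using (∃-syntax; _×_; _,_)
open import Data.Sum using (_⊎_; inj₁; inj₂)
open import Function using (_∘_)
open import Relation.Binary.PropositionalEquality
open import Relation.Binary.Core using (_Preserves_⟶_)
open import Relation.Binary.Definitions using (tri<; tri≈; tri>)
open import Defs

Sublinear : (ℕ → ℕ) → Set
Sublinear f = ∀ K → ∃[ C ] ∀ n → K * f n ≤ n + C

bounded⇒sublinear : ∀ {f} B → (∀ n → f n ≤ B) → Sublinear f
bounded⇒sublinear B f≤B K = K * B , λ n → ℕ.≤-trans (ℕ.*-monoʳ-≤ K (f≤B n)) (ℕ.m≤n+m (K * B) n)

sublinear-≤ : ∀ {f g} → (∀ n → f n ≤ g n) → Sublinear g → Sublinear f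
sublinear-≤ f≤g sub K with sub K
... | C , bound = C , λ n → ℕ.≤-trans (ℕ.*-monoʳ-≤ K (f≤g n)) (bound n)

sublinear-∘ : ∀ {f} h → (∀ n → h n ≤ n) → Sublinear f → Sublinear (f ∘ h)
sublinear-∘ h h≤id sub K with sub K
... | C , bound = C , λ n → ℕ.≤-trans (bound (h n)) (ℕ.+-monoˡ-≤ C (h≤id n))

sublinear-*ˡ : ∀ {f} k → Sublinear f → Sublinear (λ n → k * f n)
sublinear-*ˡ {f} k sub K with sub (K * k)
... | C , bound = C , λ n → ℕ.≤-trans (ℕ.≤-reflexive (sym (ℕ.*-assoc K k (f n)))) (bound n)

sublinear-+ : ∀ {f g} → Sublinear f → Sublinear g → Sublinear (λ n → f n + g n)
sublinear-+ {f} {g} subf subg K with subf (2 * K) | subg (2 * K)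
... | C₁ , bf | C₂ , bg = C₁ + C₂ , λ n → ℕ.*-cancelˡ-≤ 2 (begin
  2 * (K * (f n + g n))           ≡⟨ split K (f n) (g n) ⟩
  2 * K * f n + 2 * K * g n       ≤⟨ ℕ.+-mono-≤ (bf n) (bg n) ⟩
  (n + C₁) + (n + C₂)             ≤⟨ ℕ.m≤m+n _ (C₁ + C₂) ⟩
  (n + C₁) + (n + C₂) + (C₁ + C₂) ≡⟨ regroup n C₁ C₂ ⟩
  2 * (n + (C₁ + C₂))             ∎)
  where
  open ℕ.≤-Reasoning
  split : ∀ K x y → 2 * (K * (x + y)) ≡ 2 * K * x + 2 * K * y
  split = solve-∀
  regroup : ∀ n C₁ C₂ → (n + C₁) + (n + C₂) + (C₁ + C₂) ≡ 2 * (n + (C₁ + C₂))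
  regroup = solve-∀

⌊n/2⌋+⌊n/2⌋≤n : ∀ n → ⌊ n /2⌋ + ⌊ n /2⌋ ≤ n
⌊n/2⌋+⌊n/2⌋≤n n = ℕ.≤-trans (ℕ.+-monoʳ-≤ ⌊ n /2⌋ (ℕ.⌊n/2⌋≤⌈n/2⌉ n)) (ℕ.≤-reflexive (ℕ.⌊n/2⌋+⌈n/2⌉≡n n))

-- An increment d per halving gives D n = O(d log n).
halving⇒sublinear : ∀ {D : ℕ → ℕ} d → D 0 ≡ 0 → (∀ n → D n ≤ d + D ⌊ n /2⌋) → Sublinear D
halving⇒sublinear {D} d D0≡0 step K = C , <-rec _ bound
  where
  C = K * d * (2 * K * d)
  linear : ∀ n → (∀ {m} → m < n → D m ≤ d * m) → D n ≤ d * n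
  linear zero    _   = ℕ.≤-reflexive (trans D0≡0 (sym (ℕ.*-zeroʳ d)))
  linear (suc n) rec = begin
    D (suc n)                 ≤⟨ step (suc n) ⟩
    d + D ⌊ suc n /2⌋         ≤⟨ ℕ.+-monoʳ-≤ d (rec (ℕ.⌊n/2⌋<n n)) ⟩
    d + d * ⌊ suc n /2⌋       ≤⟨ ℕ.+-monoʳ-≤ d (ℕ.*-monoʳ-≤ d (ℕ.≤-pred (ℕ.⌊n/2⌋<n n))) ⟩
    d + d * n                 ≡⟨ ℕ.*-suc d n ⟨
    d * suc n                 ∎
    where open ℕ.≤-Reasoning
  bound : ∀ n → (∀ {m} → m < n → K * D m ≤ m + C) → K * D n ≤ n + C
  bound n rec with n ℕ.≤? 2 * K * d
  ... | yes small = begin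
    K * D n                 ≤⟨ ℕ.*-monoʳ-≤ K (ℕ.≤-trans (<-rec _ linear n) (ℕ.*-monoʳ-≤ d small)) ⟩
    K * (d * (2 * K * d))   ≡⟨ ℕ.*-assoc K d _ ⟨
    C                       ≤⟨ ℕ.m≤n+m C n ⟩
    n + C                   ∎
    where open ℕ.≤-Reasoning
  bound n@(suc n′) rec | no large = begin
    K * D n                 ≤⟨ ℕ.*-monoʳ-≤ K (step n) ⟩
    K * (d + D h)           ≡⟨ ℕ.*-distribˡ-+ K d (D h) ⟩
    K * d + K * D h         ≤⟨ ℕ.+-monoʳ-≤ (K * d) (rec (ℕ.⌊n/2⌋<n n′)) ⟩
    K * d + (h + C)         ≡⟨ ℕ.+-assoc (K * d) h C ⟨
    K * d + h + C           ≤⟨ ℕ.+-monoˡ-≤ C (ℕ.*-cancelˡ-≤ 2 (begin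
      2 * (K * d + h)         ≡⟨ regroup K d h ⟩
      2 * K * d + (h + h)     ≤⟨ ℕ.+-mono-≤ (ℕ.<⇒≤ (ℕ.≰⇒> large)) (⌊n/2⌋+⌊n/2⌋≤n n) ⟩
      n + n                   ≡⟨ cong (λ k → n + k) (ℕ.+-identityʳ n) ⟨
      2 * n                   ∎)) ⟩
    n + C                   ∎
    where
    open ℕ.≤-Reasoning
    h = ⌊ n /2⌋
    regroup : ∀ K d h → 2 * (K * d + h) ≡ 2 * K * d + (h + h)
    regroup = solve-∀
  bound zero rec | no large = ⊥-elim (large z≤n)

sum< : (ℕ → ℤ) → ℕ → ℤ
sum< f zero    = + 0
sum< f (suc n) = sum< f n ℤ.+ f n

sum<-cong : ∀ {f g} n → (∀ i → i < n → f i ≡ g i) → sum< f n ≡ sum< g n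
sum<-cong zero    f≡g = refl
sum<-cong (suc n) f≡g =
  cong₂ ℤ._+_ (sum<-cong n (λ i i<n → f≡g i (ℕ.m≤n⇒m≤1+n i<n))) (f≡g n ℕ.≤-refl)

sum<-distrib-+ : ∀ f g n → sum< (λ i → f i ℤ.+ g i) n ≡ sum< f n ℤ.+ sum< g n
sum<-distrib-+ f g zero    = refl
sum<-distrib-+ f g (suc n) rewrite sum<-distrib-+ f g n = interchange (sum< f n) (sum< g n) (f n) (g n)
  where
  interchange : ∀ a b c d → (a ℤ.+ b) ℤ.+ (c ℤ.+ d) ≡ (a ℤ.+ c) ℤ.+ (b ℤ.+ d)
  interchange = ℤ-Ring.solve-∀

sum<-distribˡ-* : ∀ k f n → sum< (λ i → k ℤ.* f i) n ≡ k ℤ.* sum< f n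
sum<-distribˡ-* k f zero    = sym (ℤ.*-zeroʳ k)
sum<-distribˡ-* k f (suc n) rewrite sum<-distribˡ-* k f n = sym (ℤ.*-distribˡ-+ k (sum< f n) (f n))

sum<-+ : ∀ f m n → sum< f (m + n) ≡ sum< f n ℤ.+ sum< (λ i → f (i + n)) m
sum<-+ f zero    n = sym (ℤ.+-identityʳ (sum< f n))
sum<-+ f (suc m) n rewrite sum<-+ f m n = ℤ.+-assoc (sum< f n) _ (f (m + n))

sum<-* : ∀ f T k → sum< f (T * k) ≡ sum< (λ t → sum< (λ i → f (i + t * k)) k) T
sum<-* f zero    k = refl
sum<-* f (suc T) k rewrite sum<-+ f k (T * k) | sum<-* f T k = refl

sum<-*2 : ∀ f h → sum< f (h * 2) ≡ sum< (λ u → f (u * 2)) h ℤ.+ sum< (λ u → f (suc (u * 2))) h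
sum<-*2 f zero    = refl
sum<-*2 f (suc h) rewrite sum<-*2 f h =
  interchange (sum< (λ u → f (u * 2)) h) (sum< (λ u → f (suc (u * 2))) h) (f (h * 2)) (f (suc (h * 2)))
  where
  interchange : ∀ a b c d → (a ℤ.+ b) ℤ.+ c ℤ.+ d ≡ (a ℤ.+ c) ℤ.+ (b ℤ.+ d)
  interchange = ℤ-Ring.solve-∀

∣sum<∣≤ : ∀ {f} c → (∀ i → ∣ f i ∣ ≤ c) → ∀ n → ∣ sum< f n ∣ ≤ n * c
∣sum<∣≤         c ∣f∣≤c zero    = z≤n
∣sum<∣≤ {f} c ∣f∣≤c (suc n) = begin
  ∣ sum< f n ℤ.+ f n ∣  ≤⟨ ℤ.∣i+j∣≤∣i∣+∣j∣ (sum< f n) (f n) ⟩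
  ∣ sum< f n ∣ + ∣ f n ∣ ≤⟨ ℕ.+-mono-≤ (∣sum<∣≤ c ∣f∣≤c n) (∣f∣≤c n) ⟩
  n * c + c             ≡⟨ ℕ.+-comm (n * c) c ⟩
  suc n * c             ∎
  where open ℕ.≤-Reasoning

⌊n/2⌋-parity : ∀ n → n ≡ ⌊ n /2⌋ * 2 ⊎ n ≡ suc (⌊ n /2⌋ * 2)
⌊n/2⌋-parity 0             = inj₁ refl
⌊n/2⌋-parity 1             = inj₂ refl
⌊n/2⌋-parity (suc (suc n)) with ⌊n/2⌋-parity n
... | inj₁ n≡ = inj₁ (cong (suc ∘ suc) n≡)
... | inj₂ n≡ = inj₂ (cong (suc ∘ suc) n≡)

module _ {f : ℕ → ℤ} (c : ℕ) (∣f∣≤c : ∀ i → ∣ f i ∣ ≤ c) where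

  ∣sum<∣-⌊/2⌋ : ∀ n → ∣ sum< f n ∣ ≤ c + ∣ sum< f (⌊ n /2⌋ * 2) ∣
  ∣sum<∣-⌊/2⌋ n with ⌊n/2⌋-parity n
  ... | inj₁ n≡ = subst (λ k → ∣ sum< f k ∣ ≤ c + ∣ sum< f (⌊ n /2⌋ * 2) ∣) (sym n≡) (ℕ.m≤n+m _ c)
  ... | inj₂ n≡ = subst (λ k → ∣ sum< f k ∣ ≤ c + ∣ sum< f (⌊ n /2⌋ * 2) ∣) (sym n≡) (begin
    ∣ sum< f (h * 2) ℤ.+ f (h * 2) ∣  ≤⟨ ℤ.∣i+j∣≤∣i∣+∣j∣ (sum< f (h * 2)) (f (h * 2)) ⟩
    ∣ sum< f (h * 2) ∣ + ∣ f (h * 2) ∣ ≤⟨ ℕ.+-monoʳ-≤ _ (∣f∣≤c (h * 2)) ⟩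
    ∣ sum< f (h * 2) ∣ + c            ≡⟨ ℕ.+-comm _ c ⟩
    c + ∣ sum< f (h * 2) ∣            ∎)
    where
    open ℕ.≤-Reasoning
    h = ⌊ n /2⌋

  module _ (cancel : ∀ v → f (1 + v * 2) ℤ.+ f (2 + v * 2) ≡ + 0) where

    sum<-odd : ∀ v → sum< f (suc (v * 2)) ≡ f 0
    sum<-odd zero    = ℤ.+-identityˡ (f 0)
    sum<-odd (suc v) = begin
      sum< f (suc (v * 2)) ℤ.+ f (1 + v * 2) ℤ.+ f (2 + v * 2)    ≡⟨ ℤ.+-assoc (sum< f (suc (v * 2))) _ _ ⟩
      sum< f (suc (v * 2)) ℤ.+ (f (1 + v * 2) ℤ.+ f (2 + v * 2))  ≡⟨ cong₂ ℤ._+_ (sum<-odd v) (cancel v) ⟩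
      f 0 ℤ.+ + 0                                                 ≡⟨ ℤ.+-identityʳ (f 0) ⟩
      f 0                                                         ∎
      where open ≡-Reasoning

    ∣sum<∣≤-cancelling : ∀ n → ∣ sum< f n ∣ ≤ c + c
    ∣sum<∣≤-cancelling zero    = z≤n
    ∣sum<∣≤-cancelling (suc m) with ⌊n/2⌋-parity m
    ... | inj₁ m≡ = subst (λ k → ∣ sum< f (suc k) ∣ ≤ c + c) (sym m≡)
                      (subst (λ x → ∣ x ∣ ≤ c + c) (sym (sum<-odd ⌊ m /2⌋)) (ℕ.≤-trans (∣f∣≤c 0) (ℕ.m≤m+n c c)))
    ... | inj₂ m≡ = subst (λ k → ∣ sum< f (suc k) ∣ ≤ c + c) (sym m≡)
                      (subst (λ x → ∣ x ℤ.+ f (suc (⌊ m /2⌋ * 2)) ∣ ≤ c + c) (sym (sum<-odd ⌊ m /2⌋))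
                        (ℕ.≤-trans (ℤ.∣i+j∣≤∣i∣+∣j∣ (f 0) _) (ℕ.+-mono-≤ (∣f∣≤c 0) (∣f∣≤c _))))

SublinearSums : (ℕ → ℤ) → Set
SublinearSums f = Sublinear (λ T → ∣ sum< f T ∣)

sublinearSums-+ : ∀ {f g} → SublinearSums f → SublinearSums g → SublinearSums (λ i → f i ℤ.+ g i)
sublinearSums-+ {f} {g} subf subg = sublinear-≤
  (λ T → ℕ.≤-trans (ℕ.≤-reflexive (cong ∣_∣ (sum<-distrib-+ f g T))) (ℤ.∣i+j∣≤∣i∣+∣j∣ (sum< f T) (sum< g T)))
  (sublinear-+ subf subg)

sublinearSums-* : ∀ {f} k → SublinearSums f → SublinearSums (λ i → k ℤ.* f i)
sublinearSums-* {f} k subf = sublinear-≤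
  (λ T → ℕ.≤-reflexive (trans (cong ∣_∣ (sum<-distribˡ-* k f T)) (ℤ.abs-* k (sum< f T))))
  (sublinear-*ˡ ∣ k ∣ subf)

sublinearSums-0 : SublinearSums (λ _ → + 0)
sublinearSums-0 = bounded⇒sublinear 0 λ T → ℕ.≤-trans (∣sum<∣≤ 0 (λ _ → z≤n) T) (ℕ.≤-reflexive (ℕ.*-zeroʳ T))

-- 2x/m − a/b with the denominators cleared.
deviation : (a b x m : ℕ) → ℤ
deviation a b x m = + (2 * x * b) ℤ.- + (a * m)

toℚᵘ-∣-∣ : ∀ q → toℚᵘ ℚ.∣ q ∣ ≡ ℚᵘ.∣ toℚᵘ q ∣
toℚᵘ-∣-∣ (mkℚ n d c) = refl

∣x/m-a/b∣< : ∀ x m a b p d .{c : Coprime (suc p) (suc d)} →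
          ∣ + (x * suc b) ℤ.- + (a * suc m) ∣ * suc d < suc p * (suc m * suc b) →
          ℚ.∣ + x ℚ./ suc m ℚ.- + a ℚ./ suc b ∣ ℚ.< mkℚ +[1+ p ] d c
∣x/m-a/b∣< x m a b p d lt = ℚ.toℚᵘ-cancel-< (subst (ℚᵘ._< _) (sym (toℚᵘ-∣-∣ (x/m ℚ.- a/b)))
                           (ℚᵘ.<-respˡ-≃ (ℚᵘ.≃-sym (ℚᵘ.∣-∣-cong toℚᵘ-difference)) unnormalised))
  where
  x/m a/b : ℚ.ℚ
  x/m = + x ℚ./ suc m
  a/b = + a ℚ./ suc b
  difference : ℚᵘ.ℚᵘ
  difference = ℚᵘ.mkℚᵘ (+ x) m ℚᵘ.+ ℚᵘ.- ℚᵘ.mkℚᵘ (+ a) b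
  toℚᵘ-difference : toℚᵘ (x/m ℚ.- a/b) ℚᵘ.≃ difference
  toℚᵘ-difference = ℚᵘ.≃-trans (ℚ.toℚᵘ-homo-+ x/m (ℚ.- a/b))
    (ℚᵘ.+-cong (ℚ.toℚᵘ-fromℚᵘ (ℚᵘ.mkℚᵘ (+ x) m))
               (ℚᵘ.≃-trans (ℚ.toℚᵘ-homo‿- a/b) (ℚᵘ.-‿cong (ℚ.toℚᵘ-fromℚᵘ (ℚᵘ.mkℚᵘ (+ a) b)))))
  numerator : + x ℤ.* + suc b ℤ.+ ℤ.- + a ℤ.* + suc m ≡ + (x * suc b) ℤ.- + (a * suc m)
  numerator = cong₂ ℤ._+_ (sym (ℤ.pos-* x (suc b)))
                          (trans (sym (ℤ.neg-distribˡ-* (+ a) (+ suc m))) (cong ℤ.-_ (sym (ℤ.pos-* a (suc m)))))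
  unnormalised : ℚᵘ.∣ difference ∣ ℚᵘ.< ℚᵘ.mkℚᵘ +[1+ p ] d
  unnormalised = ℚᵘ.*<* (subst₂ ℤ._<_ (ℤ.pos-* ∣ + x ℤ.* + suc b ℤ.+ ℤ.- + a ℤ.* + suc m ∣ (suc d))
                                       (ℤ.pos-* (suc p) (suc m * suc b))
                   (ℤ.+<+ (subst (λ z → ∣ z ∣ * suc d < suc p * (suc m * suc b)) (sym numerator) lt)))

densityIs-sublinear : ∀ {n} (σ : Vec ℕ n) a b →
                      Sublinear (λ M → ∣ deviation a (suc b) (Γ σ M) M ∣) → densityIs σ (+ a ℚ./ suc b)
densityIs-sublinear σ a b sub ε@(mkℚ +[1+ p ] d _) _ with sub (2 * suc d)
... | C , bound = suc C , close
  where
  close : ∀ M → suc C ≤ M → ℚ.∣ ratio σ M ℚ.- + a ℚ./ suc b ∣ ℚ.< ε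
  close (suc m) (s≤s C≤m) = ∣x/m-a/b∣< (2 * Γ σ (suc m)) m a b p d (ℕ.*-cancelˡ-< 2 _ _ (begin-strict
    2 * (∣ z ∣ * suc d)                ≡⟨ cong (2 *_) (ℕ.*-comm ∣ z ∣ (suc d)) ⟩
    2 * (suc d * ∣ z ∣)                ≡⟨ ℕ.*-assoc 2 (suc d) ∣ z ∣ ⟨
    2 * suc d * ∣ z ∣                  ≤⟨ bound (suc m) ⟩
    suc m + C                          <⟨ ℕ.+-monoʳ-< (suc m) (s≤s C≤m) ⟩
    suc m + suc m                      ≡⟨ cong (λ k → suc m + k) (ℕ.+-identityʳ (suc m)) ⟨
    2 * suc m                          ≤⟨ ℕ.*-monoʳ-≤ 2 (ℕ.≤-trans (ℕ.m≤m*n (suc m) (suc b))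
                                                                  (ℕ.m≤n*m (suc m * suc b) (suc p))) ⟩
    2 * (suc p * (suc m * suc b))      ∎))
    where
    open ℕ.≤-Reasoning
    z = deviation a (suc b) (Γ σ (suc m)) (suc m)
densityIs-sublinear σ a b sub (mkℚ (+ 0) d _)     (ℚ.*<* (ℤ.+<+ ()))
densityIs-sublinear σ a b sub (mkℚ -[1+ p ] d _) (ℚ.*<* ())

ind : Bool → ℕ
ind b = if b then 1 else 0

counted : ∀ {n} → Vec ℕ n → ℕ → Bool
counted {n} σ m = isOdd m ∧ hasPattern (orbit n m) σ

deviation-+ : ∀ a b x y m n → deviation a b (x + y) (m + n) ≡ deviation a b x m ℤ.+ deviation a b y n
deviation-+ a b x y m n = begin
  + (2 * (x + y) * b) ℤ.- + (a * (m + n))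
    ≡⟨ cong₂ (λ u v → + u ℤ.- + v) (distrib x y b) (ℕ.*-distribˡ-+ a m n) ⟩
  + (2 * x * b + 2 * y * b) ℤ.- + (a * m + a * n)
    ≡⟨ cong₂ ℤ._-_ (ℤ.pos-+ (2 * x * b) (2 * y * b)) (ℤ.pos-+ (a * m) (a * n)) ⟩
  (+ (2 * x * b) ℤ.+ + (2 * y * b)) ℤ.- (+ (a * m) ℤ.+ + (a * n))
    ≡⟨ interchange (+ (2 * x * b)) (+ (2 * y * b)) (+ (a * m)) (+ (a * n)) ⟩
  (+ (2 * x * b) ℤ.- + (a * m)) ℤ.+ (+ (2 * y * b) ℤ.- + (a * n)) ∎
  where
  open ≡-Reasoning
  distrib : ∀ x y b → 2 * (x + y) * b ≡ 2 * x * b + 2 * y * b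
  distrib = solve-∀
  interchange : ∀ p q r u → (p ℤ.+ q) ℤ.- (r ℤ.+ u) ≡ (p ℤ.- r) ℤ.+ (q ℤ.- u)
  interchange = ℤ-Ring.solve-∀

∣deviation∣≤ : ∀ a b x m → ∣ deviation a b x m ∣ ≤ 2 * x * b + a * m
∣deviation∣≤ a b x m = ℤ.∣i-j∣≤∣i∣+∣j∣ (+ (2 * x * b)) (+ (a * m))

Γ-deviation : ∀ {n} (σ : Vec ℕ n) a b M →
              deviation a b (Γ σ M) M ≡ sum< (λ m → deviation a b (ind (counted σ (suc m))) 1) M
Γ-deviation σ a b zero    = cong (λ k → + 0 ℤ.- + k) (ℕ.*-zeroʳ a)
Γ-deviation σ a b (suc M) = begin
  deviation a b (ind (counted σ (suc M)) + Γ σ M) (1 + M)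
    ≡⟨ deviation-+ a b (ind (counted σ (suc M))) (Γ σ M) 1 M ⟩
  deviation a b (ind (counted σ (suc M))) 1 ℤ.+ deviation a b (Γ σ M) M
    ≡⟨ ℤ.+-comm _ (deviation a b (Γ σ M) M) ⟩
  deviation a b (Γ σ M) M ℤ.+ deviation a b (ind (counted σ (suc M))) 1
    ≡⟨ cong (ℤ._+ deviation a b (ind (counted σ (suc M))) 1) (Γ-deviation σ a b M) ⟩
  sum< (λ m → deviation a b (ind (counted σ (suc m))) 1) (suc M) ∎
  where open ≡-Reasoning

blockDeviation : ∀ {n} → Vec ℕ n → (a b t : ℕ) → ℤ
blockDeviation σ a b t = sum< (λ i → deviation a b (ind (counted σ (suc i + t * 16))) 1) 16

sublinear-deviation : ∀ {n} (σ : Vec ℕ n) a b → SublinearSums (blockDeviation σ a b) →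
                      Sublinear (λ M → ∣ deviation a b (Γ σ M) M ∣)
sublinear-deviation σ a b sub =
  sublinear-≤ split (sublinear-+ (sublinear-∘ (_/ 16) (λ M → m/n≤m M 16) sub) (bounded⇒sublinear _ λ _ → ℕ.≤-refl))
  where
  w : ℕ → ℤ
  w m = deviation a b (ind (counted σ (suc m))) 1
  ∣w∣≤ : ∀ m → ∣ w m ∣ ≤ 2 * b + a
  ∣w∣≤ m = ℕ.≤-trans (∣deviation∣≤ a b (ind (counted σ (suc m))) 1)
             (ℕ.+-mono-≤ (ℕ.*-monoˡ-≤ b (ℕ.*-monoʳ-≤ 2 (ind≤1 (counted σ (suc m))))) (ℕ.≤-reflexive (ℕ.*-identityʳ a)))
    where
    ind≤1 : ∀ c → ind c ≤ 1
    ind≤1 true  = ℕ.≤-refl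
    ind≤1 false = z≤n
  split : ∀ M → ∣ deviation a b (Γ σ M) M ∣ ≤ ∣ sum< (blockDeviation σ a b) (M / 16) ∣ + 15 * (2 * b + a)
  split M = begin
    ∣ deviation a b (Γ σ M) M ∣
      ≡⟨ cong ∣_∣ (trans (Γ-deviation σ a b M) (cong (sum< w) (m≡m%n+[m/n]*n M 16))) ⟩
    ∣ sum< w (M % 16 + M / 16 * 16) ∣
      ≡⟨ cong ∣_∣ (trans (sum<-+ w (M % 16) (M / 16 * 16)) (cong (ℤ._+ remainder) (sum<-* w (M / 16) 16))) ⟩
    ∣ sum< (blockDeviation σ a b) (M / 16) ℤ.+ remainder ∣
      ≤⟨ ℤ.∣i+j∣≤∣i∣+∣j∣ (sum< (blockDeviation σ a b) (M / 16)) remainder ⟩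
    ∣ sum< (blockDeviation σ a b) (M / 16) ∣ + ∣ remainder ∣
      ≤⟨ ℕ.+-monoʳ-≤ _ (ℕ.≤-trans (∣sum<∣≤ (2 * b + a) (∣w∣≤ ∘ (_+ M / 16 * 16)) (M % 16))
                                   (ℕ.*-monoˡ-≤ (2 * b + a) (ℕ.≤-pred (m%n<n M 16)))) ⟩
    ∣ sum< (blockDeviation σ a b) (M / 16) ∣ + 15 * (2 * b + a) ∎
    where
    open ℕ.≤-Reasoning
    remainder = sum< (λ i → w (i + M / 16 * 16)) (M % 16)

-- Odd parts and the Syracuse map

[r+t*kn]%n≡r%n : ∀ r k n t .{{_ : ℕ.NonZero n}} → (r + t * (k * n)) % n ≡ r % n
[r+t*kn]%n≡r%n r k n t = trans (cong (λ x → (r + x) % n) (sym (ℕ.*-assoc t k n))) ([m+kn]%n≡m%n r (t * k) n)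

0<n/2 : ∀ {n} → 0 < n → n % 2 ≡ 0 → 0 < n / 2
0<n/2 {n} 0<n n%2≡0 = ℕ.n≢0⇒n>0 λ n/2≡0 → ℕ.<⇒≢ 0<n (sym (begin
  n                 ≡⟨ m≡m%n+[m/n]*n n 2 ⟩
  n % 2 + n / 2 * 2 ≡⟨ cong₂ (λ r q → r + q * 2) n%2≡0 n/2≡0 ⟩
  0                 ∎))
  where open ≡-Reasoning

oddPartF-odd : ∀ f {n} → n % 2 ≡ 1 → oddPartF f n ≡ n
oddPartF-odd zero    n%2≡1 = refl
oddPartF-odd (suc f) n%2≡1 rewrite n%2≡1 = refl

oddPartF-fuel : ∀ f g {n} → 0 < n → n ≤ f → n ≤ g → oddPartF f n ≡ oddPartF g n
oddPartF-fuel (suc f) (suc g) {n@(suc _)} 0<n n≤f n≤g with n % 2 ≡ᵇ 0 in even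
... | false = refl
... | true  = oddPartF-fuel f g (0<n/2 0<n (ℕ.≡ᵇ⇒≡ _ _ (subst T (sym even) _)))
                (ℕ.<⇒≤pred (ℕ.<-≤-trans n/2<n n≤f)) (ℕ.<⇒≤pred (ℕ.<-≤-trans n/2<n n≤g))
  where n/2<n = m/n<m n 2 (s≤s (s≤s z≤n))

oddPartF-≤ : ∀ f n → oddPartF f n ≤ n
oddPartF-≤ zero    n = ℕ.≤-refl
oddPartF-≤ (suc f) n with (n % 2 ≡ᵇ 0) ∧ not (n ≡ᵇ 0)
... | false = ℕ.≤-refl
... | true  = ℕ.≤-trans (oddPartF-≤ f (n / 2)) (m/n≤m n 2)

oddPartF-%2 : ∀ f {n} → 0 < n → n ≤ f → oddPartF f n % 2 ≡ 1
oddPartF-%2 (suc f) {n@(suc _)} 0<n n≤f with n % 2 ≡ᵇ 0 in even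
... | true  = oddPartF-%2 f (0<n/2 0<n (ℕ.≡ᵇ⇒≡ _ _ (subst T (sym even) _)))
                (ℕ.<⇒≤pred (ℕ.<-≤-trans (m/n<m n 2 (s≤s (s≤s z≤n))) n≤f))
... | false = nonzero-remainder even (m%n<n n 2)
  where
  nonzero-remainder : ∀ {r} → (r ≡ᵇ 0) ≡ false → r < 2 → r ≡ 1
  nonzero-remainder {1}           _ _                 = refl
  nonzero-remainder {suc (suc _)} _ (s≤s (s≤s ()))

oddPart-odd : ∀ {n} → n % 2 ≡ 1 → oddPart n ≡ n
oddPart-odd {n} = oddPartF-odd n

oddPartF-2* : ∀ f x → oddPartF (suc f) (2 * suc x) ≡ oddPartF f (suc x)
oddPartF-2* f x rewrite trans (cong (_% 2) (ℕ.*-comm 2 (suc x))) ([m+kn]%n≡m%n 0 (suc x) 2)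
                      | trans (cong (_/ 2) (ℕ.*-comm 2 (suc x))) (m*n/n≡m (suc x) 2) = refl

oddPart-2* : ∀ {x} → 0 < x → oddPart (2 * x) ≡ oddPart x
oddPart-2* {suc x} _ = trans (oddPartF-2* (x + suc (x + 0)) x)
  (oddPartF-fuel (x + suc (x + 0)) (suc x) (s≤s z≤n) x<2x ℕ.≤-refl)
  where
  x<2x : suc x ≤ x + suc (x + 0)
  x<2x = ℕ.≤-trans (ℕ.m≤n+m (suc x) x) (ℕ.≤-reflexive (cong (λ k → x + suc k) (sym (ℕ.+-identityʳ x))))

oddPart-2^* : ∀ k {x} → 0 < x → oddPart (2 ^ k * x) ≡ oddPart x
oddPart-2^* zero    {x} 0<x = cong oddPart (ℕ.*-identityˡ x)
oddPart-2^* (suc k) {x} 0<x = begin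
  oddPart (2 * 2 ^ k * x)   ≡⟨ cong oddPart (ℕ.*-assoc 2 (2 ^ k) x) ⟩
  oddPart (2 * (2 ^ k * x)) ≡⟨ oddPart-2* (ℕ.*-mono-< (ℕ.m^n>0 2 k) 0<x) ⟩
  oddPart (2 ^ k * x)       ≡⟨ oddPart-2^* k 0<x ⟩
  oddPart x                 ∎
  where open ≡-Reasoning

oddPart≤n : ∀ n → oddPart n ≤ n
oddPart≤n n = oddPartF-≤ n n

oddPart%2≡1 : ∀ {n} → 0 < n → oddPart n % 2 ≡ 1
oddPart%2≡1 {n} 0<n = oddPartF-%2 n 0<n ℕ.≤-refl

S-≡ : ∀ k {m x} → 0 < x → 3 * m + 1 ≡ 2 ^ k * x → S m ≡ oddPart x
S-≡ k 0<x 3m+1≡ = trans (cong oddPart 3m+1≡) (oddPart-2^* k 0<x)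

S-affine : ∀ e i j α β t → 0 < j → 3 * i + 1 ≡ 2 ^ e * j → 3 * α ≡ 2 ^ e * β →
           S (i + t * α) ≡ oddPart (j + t * β)
S-affine e i j α β t 0<j eq₀ eq₁ = S-≡ e {i + t * α} (ℕ.<-≤-trans 0<j (ℕ.m≤m+n j (t * β))) (begin
  3 * (i + t * α) + 1        ≡⟨ expand i α t ⟩
  (3 * i + 1) + t * (3 * α)  ≡⟨ cong₂ (λ x y → x + t * y) eq₀ eq₁ ⟩
  p * j + t * (p * β)        ≡⟨ factor p j β t ⟩
  p * (j + t * β)            ∎)
  where
  open ≡-Reasoning
  p = 2 ^ e
  expand : ∀ i α t → 3 * (i + t * α) + 1 ≡ (3 * i + 1) + t * (3 * α)
  expand = solve-∀
  factor : ∀ p j β t → p * j + t * (p * β) ≡ p * (j + t * β)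
  factor = solve-∀

S-affine-odd : ∀ e i j α β t → 3 * i + 1 ≡ 2 ^ e * j → 3 * α ≡ 2 ^ e * (β * 2) → j % 2 ≡ 1 →
               S (i + t * α) ≡ j + t * (β * 2)
S-affine-odd e i j@(suc _) α β t eq₀ eq₁ j-odd =
  trans (S-affine e i j α (β * 2) t (s≤s z≤n) eq₀ eq₁) (oddPart-odd (trans ([r+t*kn]%n≡r%n j β 2 t) j-odd))

-- Order patterns

T-ext : ∀ {a b} → (T a → T b) → (T b → T a) → a ≡ b
T-ext {true}  {true}  _ _ = refl
T-ext {true}  {false} a⇒b _ = ⊥-elim (a⇒b _)
T-ext {false} {true}  _ b⇒a = ⊥-elim (b⇒a _)
T-ext {false} {false} _ _ = refl

allFin-cong : ∀ n {p q : Fin n → Bool} → (∀ i → p i ≡ q i) → allFin n p ≡ allFin n q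
allFin-cong zero    p≡q = refl
allFin-cong (suc n) p≡q = cong₂ _∧_ (p≡q Fin.zero) (allFin-cong n (p≡q ∘ Fin.suc))

countFin-cong : ∀ n {p q : Fin n → Bool} → (∀ i → p i ≡ q i) → countFin n p ≡ countFin n q
countFin-cong zero    p≡q = refl
countFin-cong (suc n) p≡q =
  cong₂ _+_ (cong (λ b → if b then 1 else 0) (p≡q Fin.zero)) (countFin-cong n (p≡q ∘ Fin.suc))

-- The normal form of distinct (a ∷ b ∷ c ∷ []), spelled out because the disjunction local to distinct
-- cannot be named.
noRepeats₃ : (ab ac ba bc ca cb : Bool) → Bool
noRepeats₃ ab ac ba bc ca cb =
  (not ab ∧ (not ac ∧ true)) ∧ ((not ba ∧ (not bc ∧ true)) ∧ ((not ca ∧ (not cb ∧ true)) ∧ true))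

module _ {g : ℕ → ℕ} (mono : g Preserves _<_ ⟶ _<_) where

  strictMono-cancel-< : ∀ {u v} → g u < g v → u < v
  strictMono-cancel-< {u} {v} gu<gv with ℕ.<-cmp u v
  ... | tri< u<v _ _ = u<v
  ... | tri≈ _ refl _ = ⊥-elim (ℕ.<-irrefl refl gu<gv)
  ... | tri> _ _ v<u = ⊥-elim (ℕ.<-asym gu<gv (mono v<u))

  strictMono-injective : ∀ {u v} → g u ≡ g v → u ≡ v
  strictMono-injective {u} {v} gu≡gv with ℕ.<-cmp u v
  ... | tri< u<v _ _ = ⊥-elim (ℕ.<-irrefl gu≡gv (mono u<v))
  ... | tri≈ _ u≡v _ = u≡v
  ... | tri> _ _ v<u = ⊥-elim (ℕ.<-irrefl (sym gu≡gv) (mono v<u))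

  <ᵇ-strictMono : ∀ u v → (g u <ᵇ g v) ≡ (u <ᵇ v)
  <ᵇ-strictMono u v = T-ext (λ t → ℕ.<⇒<ᵇ (strictMono-cancel-< (ℕ.<ᵇ⇒< _ _ t)))
                            (λ t → ℕ.<⇒<ᵇ (mono (ℕ.<ᵇ⇒< _ _ t)))

  ≡ᵇ-strictMono : ∀ u v → (g u ≡ᵇ g v) ≡ (u ≡ᵇ v)
  ≡ᵇ-strictMono u v = T-ext (λ t → ℕ.≡⇒≡ᵇ _ _ (strictMono-injective (ℕ.≡ᵇ⇒≡ _ _ t)))
                            (λ t → ℕ.≡⇒≡ᵇ _ _ (cong g (ℕ.≡ᵇ⇒≡ _ _ t)))

  rank-map : ∀ {n} (x : Vec ℕ n) i → rank (map g x) i ≡ rank x i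
  rank-map {n} x i = cong suc (countFin-cong n λ j →
    trans (cong₂ _<ᵇ_ (lookup-map j g x) (lookup-map i g x)) (<ᵇ-strictMono _ _))

  distinct-map : (x : Vec ℕ 3) → distinct (map g x) ≡ distinct x
  distinct-map (a ∷ b ∷ c ∷ []) = unfolded
    where
    unfolded : noRepeats₃ (g a ≡ᵇ g b) (g a ≡ᵇ g c) (g b ≡ᵇ g a) (g b ≡ᵇ g c) (g c ≡ᵇ g a) (g c ≡ᵇ g b)
             ≡ noRepeats₃ (a ≡ᵇ b) (a ≡ᵇ c) (b ≡ᵇ a) (b ≡ᵇ c) (c ≡ᵇ a) (c ≡ᵇ b)
    unfolded rewrite ≡ᵇ-strictMono a b | ≡ᵇ-strictMono a c | ≡ᵇ-strictMono b a
                   | ≡ᵇ-strictMono b c | ≡ᵇ-strictMono c a | ≡ᵇ-strictMono c b = refl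

  hasPattern-map : (x σ : Vec ℕ 3) → hasPattern (map g x) σ ≡ hasPattern x σ
  hasPattern-map x σ =
    cong₂ _∧_ (distinct-map x) (allFin-cong 3 λ i → cong (_≡ᵇ lookup σ i) (rank-map x i))

step⇒strictMono : ∀ {g : ℕ → ℕ} → (∀ n → g n < g (suc n)) → g Preserves _<_ ⟶ _<_
step⇒strictMono {g} step {u} {suc v} (s≤s u≤v) with ℕ.m≤n⇒m<n∨m≡n u≤v
... | inj₁ u<v  = ℕ.<-trans (step⇒strictMono step u<v) (step v)
... | inj₂ refl = step v

ascending : ℕ → ℕ → ℕ → ℕ → ℕ
ascending a b c 0                   = a
ascending a b c 1                   = b
ascending a b c 2                   = c
ascending a b c (suc (suc (suc k))) = suc (c + k)

ascending-strictMono : ∀ {a b c} → a < b → b < c → ascending a b c Preserves _<_ ⟶ _<_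
ascending-strictMono {a} {b} {c} a<b b<c = step⇒strictMono step
  where
  step : ∀ n → ascending a b c n < ascending a b c (suc n)
  step 0                   = a<b
  step 1                   = b<c
  step 2                   = s≤s (ℕ.m≤m+n c 0)
  step (suc (suc (suc k))) = s≤s (ℕ.+-monoʳ-< c (ℕ.n<1+n k))

affine-< : ∀ a b c d t → {T (a <ᵇ b)} → {T (c ℕ.≤ᵇ d)} → a + t * c < b + t * d
affine-< a b c d t {a<b} {c≤d} = ℕ.+-mono-<-≤ (ℕ.<ᵇ⇒< a b a<b) (ℕ.*-monoʳ-≤ t (ℕ.≤ᵇ⇒≤ c d c≤d))

orbit₃ : ∀ {m s₁ s₂} → S m ≡ s₁ → S s₁ ≡ s₂ → orbit 3 m ≡ m ∷ s₁ ∷ s₂ ∷ []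
orbit₃ {m} refl refl = refl

-- τ lists the 0-based ranks of m, S m, S² m; the pattern is then τ shifted by one.
orbit-pattern : ∀ {m s₁ s₂ a b c} → S m ≡ s₁ → S s₁ ≡ s₂ → a < b → b < c →
                (τ : Vec ℕ 3) → map (ascending a b c) τ ≡ m ∷ s₁ ∷ s₂ ∷ [] →
                ∀ σ → hasPattern (orbit 3 m) σ ≡ hasPattern (map suc τ) σ
orbit-pattern {m} {s₁} {s₂} {a} {b} {c} Sm≡s₁ Ss₁≡s₂ a<b b<c τ τ↦orbit σ = begin
  hasPattern (orbit 3 m) σ                 ≡⟨ cong (λ v → hasPattern v σ) (orbit₃ {m} Sm≡s₁ Ss₁≡s₂) ⟩
  hasPattern (m ∷ s₁ ∷ s₂ ∷ []) σ          ≡⟨ cong (λ v → hasPattern v σ) τ↦orbit ⟨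
  hasPattern (map (ascending a b c) τ) σ   ≡⟨ hasPattern-map (ascending-strictMono a<b b<c) τ σ ⟩
  hasPattern τ σ                           ≡⟨ hasPattern-map (λ u<v → s≤s u<v) τ σ ⟨
  hasPattern (map suc τ) σ                 ∎
  where open ≡-Reasoning

-- Orbit patterns by residue mod 16

σ₁₂₃ σ₁₃₂ σ₂₁₃ σ₂₃₁ σ₃₁₂ σ₃₂₁ : Vec ℕ 3
σ₁₂₃ = 1 ∷ 2 ∷ 3 ∷ []
σ₁₃₂ = 1 ∷ 3 ∷ 2 ∷ []
σ₂₁₃ = 2 ∷ 1 ∷ 3 ∷ []
σ₂₃₁ = 2 ∷ 3 ∷ 1 ∷ []
σ₃₁₂ = 3 ∷ 1 ∷ 2 ∷ []
σ₃₂₁ = 3 ∷ 2 ∷ 1 ∷ []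

pattern-1 : ∀ t σ → hasPattern (orbit 3 (1 + t * 16)) σ ≡ hasPattern σ₃₂₁ σ ∧ not (t ≡ᵇ 0)
pattern-1 zero        σ = sym (∧-zeroʳ (hasPattern σ₃₂₁ σ))
pattern-1 t@(suc _) σ = trans
  (orbit-pattern (S-affine-odd 2 1 1 16 6 t refl refl refl) (S-affine 2 1 1 12 9 t (s≤s z≤n) refl refl)
                 (ℕ.≤-<-trans (oddPart≤n (1 + t * 9)) (slope-< 9 12)) (slope-< 12 16) (2 ∷ 1 ∷ 0 ∷ []) refl σ)
  (sym (∧-identityʳ (hasPattern σ₃₂₁ σ)))
  where
  slope-< : ∀ c d → {T (c <ᵇ d)} → 1 + t * c < 1 + t * d
  slope-< c d {c<d} = ℕ.+-monoʳ-< 1 (ℕ.*-monoʳ-< t (ℕ.<ᵇ⇒< c d c<d))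

pattern-3 : ∀ t σ → hasPattern (orbit 3 (3 + t * 16)) σ ≡ hasPattern σ₂₃₁ σ
pattern-3 t = orbit-pattern (S-affine-odd 1 3 5 16 12 t refl refl refl) (S-affine 3 5 2 24 9 t (s≤s z≤n) refl refl)
                (ℕ.≤-<-trans (oddPart≤n (2 + t * 9)) (affine-< 2 3 9 16 t)) (affine-< 3 5 16 24 t)
                (1 ∷ 2 ∷ 0 ∷ []) refl

pattern-7 : ∀ t σ → hasPattern (orbit 3 (7 + t * 16)) σ ≡ hasPattern σ₁₂₃ σ
pattern-7 t = orbit-pattern (S-affine-odd 1 7 11 16 12 t refl refl refl) (S-affine-odd 1 11 17 24 18 t refl refl refl)
                (affine-< 7 11 16 24 t) (affine-< 11 17 24 36 t) (0 ∷ 1 ∷ 2 ∷ []) refl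

pattern-9 : ∀ t σ → hasPattern (orbit 3 (9 + t * 16)) σ ≡ hasPattern σ₂₁₃ σ
pattern-9 t = orbit-pattern (S-affine-odd 2 9 7 16 6 t refl refl refl) (S-affine-odd 1 7 11 12 9 t refl refl refl)
                (affine-< 7 9 12 16 t) (affine-< 9 11 16 18 t) (1 ∷ 0 ∷ 2 ∷ []) refl

pattern-11 : ∀ t σ → hasPattern (orbit 3 (11 + t * 16)) σ ≡ hasPattern σ₁₃₂ σ
pattern-11 t = orbit-pattern (S-affine-odd 1 11 17 16 12 t refl refl refl) (S-affine-odd 2 17 13 24 9 t refl refl refl)
                 (affine-< 11 13 16 18 t) (affine-< 13 17 18 24 t) (0 ∷ 2 ∷ 1 ∷ []) refl

pattern-15 : ∀ t σ → hasPattern (orbit 3 (15 + t * 16)) σ ≡ hasPattern σ₁₂₃ σ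
pattern-15 t = orbit-pattern (S-affine-odd 1 15 23 16 12 t refl refl refl) (S-affine-odd 1 23 35 24 18 t refl refl refl)
                 (affine-< 15 23 16 24 t) (affine-< 23 35 24 36 t) (0 ∷ 1 ∷ 2 ∷ []) refl

dropPattern : ℕ → Vec ℕ 3 → Bool
dropPattern s σ = (hasPattern σ₃₁₂ σ ∧ (s % 4 ≡ᵇ 3)) ∨ (hasPattern σ₃₂₁ σ ∧ not ((s % 4 ≡ᵇ 3) ∨ (s ≡ᵇ 1)))

dropPattern-≡3 : ∀ s → s % 4 ≡ 3 → ∀ σ → dropPattern s σ ≡ hasPattern σ₃₁₂ σ
dropPattern-≡3 s s%4≡3 σ rewrite s%4≡3 =
  trans (cong₂ _∨_ (∧-identityʳ (hasPattern σ₃₁₂ σ)) (∧-zeroʳ (hasPattern σ₃₂₁ σ))) (∨-identityʳ _)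

dropPattern-≡1 : ∀ s → s % 4 ≡ 1 → (s ≡ᵇ 1) ≡ false → ∀ σ → dropPattern s σ ≡ hasPattern σ₃₂₁ σ
dropPattern-≡1 s s%4≡1 s≢1 σ rewrite s%4≡1 | s≢1 =
  cong₂ _∨_ (∧-zeroʳ (hasPattern σ₃₁₂ σ)) (∧-identityʳ (hasPattern σ₃₂₁ σ))

dropPattern-1 : ∀ σ → dropPattern 1 σ ≡ false
dropPattern-1 σ = cong₂ _∨_ (∧-zeroʳ (hasPattern σ₃₁₂ σ)) (∧-zeroʳ (hasPattern σ₃₂₁ σ))

8s≤3m+1⇒s<m : ∀ {s m} → 0 < m → 8 * s ≤ 3 * m + 1 → s < m
8s≤3m+1⇒s<m {s} {suc k} _ 8s≤ = ℕ.*-cancelˡ-< 8 s (suc k) (ℕ.≤-<-trans 8s≤ (begin-strict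
  3 * suc k + 1                     <⟨ s≤s (ℕ.m≤m+n _ (3 + k * 5)) ⟩
  suc (3 * suc k + 1) + (3 + k * 5) ≡⟨ regroup k ⟩
  8 * suc k                       ∎))
  where
  open ℕ.≤-Reasoning
  regroup : ∀ k → suc (3 * suc k + 1) + (3 + k * 5) ≡ 8 * suc k
  regroup = solve-∀

5+q*6<m : ∀ q {m} → 8 * (3 + q * 4) ≤ 3 * m + 1 → 5 + q * 6 < m
5+q*6<m q {m} 8s≤ = ℕ.*-cancelˡ-< 3 _ _ (begin-strict
  3 * (5 + q * 6) ≡⟨ expand q ⟩
  15 + q * 18     <⟨ affine-< 15 23 18 32 q ⟩
  23 + q * 32     ≤⟨ ℕ.≤-pred (subst₂ _≤_ (expand′ q) (ℕ.+-comm (3 * m) 1) 8s≤) ⟩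
  3 * m           ∎)
  where
  open ℕ.≤-Reasoning
  expand : ∀ q → 3 * (5 + q * 6) ≡ 15 + q * 18
  expand = solve-∀
  expand′ : ∀ q → 8 * (3 + q * 4) ≡ suc (23 + q * 32)
  expand′ = solve-∀

drop-pattern : ∀ {m s} → 2 ≤ m → S m ≡ s → s % 2 ≡ 1 → 8 * s ≤ 3 * m + 1 →
               ∀ σ → hasPattern (orbit 3 m) σ ≡ dropPattern s σ
drop-pattern {m} {s} 2≤m Sm≡s s-odd 8s≤ σ with s % 4 | s / 4 | m≡m%n+[m/n]*n s 4 | m%n<n s 4
... | 0 | q | refl | _ = contradiction (trans (sym ([r+t*kn]%n≡r%n 0 2 2 q)) s-odd) λ ()
... | 2 | q | refl | _ = contradiction (trans (sym ([r+t*kn]%n≡r%n 2 2 2 q)) s-odd) λ ()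
... | suc (suc (suc (suc _))) | _ | _ | s≤s (s≤s (s≤s (s≤s ())))
... | 1 | zero | refl | _ =
  trans (cong (λ v → hasPattern v σ) (orbit₃ {m} Sm≡s refl)) (trans (repeated 2≤m) (sym (dropPattern-1 σ)))
  where
  repeated : ∀ {m} → 2 ≤ m → hasPattern (m ∷ 1 ∷ 1 ∷ []) σ ≡ false
  repeated (s≤s (s≤s _)) = refl
... | 1 | suc q | refl | _ = trans
  (orbit-pattern Sm≡s (S-affine 2 5 4 4 3 q (s≤s z≤n) refl refl)
     (ℕ.≤-<-trans (oddPart≤n (4 + q * 3)) (affine-< 4 5 3 4 q)) (8s≤3m+1⇒s<m (ℕ.<-≤-trans (s≤s z≤n) 2≤m) 8s≤)
     (2 ∷ 1 ∷ 0 ∷ []) refl σ)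
  (sym (cong₂ _∨_ (∧-zeroʳ (hasPattern σ₃₁₂ σ)) (∧-identityʳ (hasPattern σ₃₂₁ σ))))
... | 3 | q | refl | _ = trans
  (orbit-pattern Sm≡s (S-affine-odd 1 3 5 4 3 q refl refl refl) (affine-< 3 5 4 6 q) (5+q*6<m q {m} 8s≤)
     (2 ∷ 0 ∷ 1 ∷ []) refl σ)
  (sym (trans (cong₂ _∨_ (∧-identityʳ (hasPattern σ₃₁₂ σ)) (∧-zeroʳ (hasPattern σ₃₂₁ σ))) (∨-identityʳ _)))

pattern-5 : ∀ t σ → hasPattern (orbit 3 (5 + t * 16)) σ ≡ dropPattern (oddPart (1 + t * 3)) σ
pattern-5 t = drop-pattern {5 + t * 16} (s≤s (s≤s z≤n)) (S-affine 4 5 1 16 3 t (s≤s z≤n) refl refl)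
                (oddPart%2≡1 {1 + t * 3} (s≤s z≤n)) (begin
  8 * oddPart (1 + t * 3) ≤⟨ ℕ.*-monoʳ-≤ 8 (oddPart≤n (1 + t * 3)) ⟩
  8 * (1 + t * 3)         ≡⟨ expand t ⟩
  8 + t * 24              ≤⟨ ℕ.+-mono-≤ (ℕ.≤ᵇ⇒≤ 8 16 _) (ℕ.*-monoʳ-≤ t (ℕ.≤ᵇ⇒≤ 24 48 _)) ⟩
  16 + t * 48             ≡⟨ expand′ t ⟩
  3 * (5 + t * 16) + 1    ∎)
  where
  open ℕ.≤-Reasoning
  expand : ∀ t → 8 * (1 + t * 3) ≡ 8 + t * 24
  expand = solve-∀
  expand′ : ∀ t → 16 + t * 48 ≡ 3 * (5 + t * 16) + 1
  expand′ = solve-∀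

pattern-13 : ∀ t σ → hasPattern (orbit 3 (13 + t * 16)) σ ≡ dropPattern (5 + t * 6) σ
pattern-13 t = drop-pattern {13 + t * 16} (s≤s (s≤s z≤n)) (S-affine-odd 3 13 5 16 3 t refl refl refl)
                 ([r+t*kn]%n≡r%n 5 3 2 t) (ℕ.≤-reflexive (expand t))
  where
  expand : ∀ t → 8 * (5 + t * 6) ≡ 3 * (13 + t * 16) + 1
  expand = solve-∀

hasPattern₅ hasPattern₁₃ : Vec ℕ 3 → ℕ → Bool
hasPattern₅  σ t = dropPattern (oddPart (1 + t * 3)) σ
hasPattern₁₃ σ t = dropPattern (5 + t * 6) σ

-- Whether r + t * 16 (1 ≤ r ≤ 16) is counted for σ; first stands for t = 0, and b₅, b₁₃ for the
-- answers at r = 5, 13, which depend on the residue of S m mod 4.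
residuePattern : Vec ℕ 3 → (first b₅ b₁₃ : Bool) → ℕ → Bool
residuePattern σ first b₅ b₁₃ 1  = hasPattern σ₃₂₁ σ ∧ not first
residuePattern σ first b₅ b₁₃ 3  = hasPattern σ₂₃₁ σ
residuePattern σ first b₅ b₁₃ 5  = b₅
residuePattern σ first b₅ b₁₃ 7  = hasPattern σ₁₂₃ σ
residuePattern σ first b₅ b₁₃ 9  = hasPattern σ₂₁₃ σ
residuePattern σ first b₅ b₁₃ 11 = hasPattern σ₁₃₂ σ
residuePattern σ first b₅ b₁₃ 13 = b₁₃
residuePattern σ first b₅ b₁₃ 15 = hasPattern σ₁₂₃ σ
residuePattern σ first b₅ b₁₃ _  = false

counted-+16 : ∀ r t σ → counted σ (r + t * 16) ≡ isOdd r ∧ hasPattern (orbit 3 (r + t * 16)) σ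
counted-+16 r t σ = cong (λ b → (b ≡ᵇ 1) ∧ hasPattern (orbit 3 (r + t * 16)) σ) ([r+t*kn]%n≡r%n r 8 2 t)

counted-residue : ∀ σ t i → i < 16 → counted σ (suc i + t * 16) ≡
                  residuePattern σ (t ≡ᵇ 0) (hasPattern₅ σ t) (hasPattern₁₃ σ t) (suc i)
counted-residue σ t 0  _ = trans (counted-+16 1 t σ) (pattern-1 t σ)
counted-residue σ t 1  _ = counted-+16 2 t σ
counted-residue σ t 2  _ = trans (counted-+16 3 t σ) (pattern-3 t σ)
counted-residue σ t 3  _ = counted-+16 4 t σ
counted-residue σ t 4  _ = trans (counted-+16 5 t σ) (pattern-5 t σ)
counted-residue σ t 5  _ = counted-+16 6 t σ
counted-residue σ t 6  _ = trans (counted-+16 7 t σ) (pattern-7 t σ)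
counted-residue σ t 7  _ = counted-+16 8 t σ
counted-residue σ t 8  _ = trans (counted-+16 9 t σ) (pattern-9 t σ)
counted-residue σ t 9  _ = counted-+16 10 t σ
counted-residue σ t 10 _ = trans (counted-+16 11 t σ) (pattern-11 t σ)
counted-residue σ t 11 _ = counted-+16 12 t σ
counted-residue σ t 12 _ = trans (counted-+16 13 t σ) (pattern-13 t σ)
counted-residue σ t 13 _ = counted-+16 14 t σ
counted-residue σ t 14 _ = trans (counted-+16 15 t σ) (pattern-15 t σ)
counted-residue σ t 15 _ = counted-+16 16 t σ
counted-residue σ t (suc (suc (suc (suc (suc (suc (suc (suc (suc (suc (suc (suc (suc (suc (suc (suc k)))))))))))))))) i<16 =
  contradiction i<16 (ℕ.m+n≮m 16 k)

residueDeviation : Vec ℕ 3 → (a b : ℕ) → (first b₅ b₁₃ : Bool) → ℤ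
residueDeviation σ a b first b₅ b₁₃ = sum< (λ i → deviation a b (ind (residuePattern σ first b₅ b₁₃ (suc i))) 1) 16

blockDeviation-residues : ∀ σ a b t → blockDeviation σ a b t ≡
  residueDeviation σ a b (t ≡ᵇ 0) (hasPattern₅ σ t) (hasPattern₁₃ σ t)
blockDeviation-residues σ a b t =
  sum<-cong 16 λ i i<16 → cong (λ c → deviation a b (ind c) 1) (counted-residue σ t i i<16)

density-from-residues : ∀ σ a b (W : ℕ → ℤ) →
  (∀ t → residueDeviation σ a (suc b) (t ≡ᵇ 0) (hasPattern₅ σ t) (hasPattern₁₃ σ t) ≡ W t) →
  SublinearSums W → densityIs σ (+ a ℚ./ suc b)
density-from-residues σ a b W residues≡W sub = densityIs-sublinear σ a b (sublinear-deviation σ a (suc b)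
  (sublinear-≤ (λ T → ℕ.≤-reflexive (cong ∣_∣ (sum<-cong T λ t _ →
     trans (blockDeviation-residues σ a (suc b) t) (residues≡W t)))) sub))

-- S m mod 4 is equidistributed

-- Splitting t by parity sends 1 + 3t to 1 + 6u or 2(2 + 3u), and 2 + 3t to 2(1 + 3u) or 5 + 6u: the sums
-- G over oddPart (1 + 3t) and H over oddPart (2 + 3t) feed into each other at half the length, so
-- ∣G∣ + ∣H∣ grows by a bounded amount per halving.
module _ (φ : ℕ → ℤ) (c : ℕ) (∣φ∣≤c : ∀ s → ∣ φ s ∣ ≤ c)
         (∣R₁∣≤c : ∀ T → ∣ sum< (λ u → φ (1 + u * 6)) T ∣ ≤ c)
         (∣R₅∣≤c : ∀ T → ∣ sum< (λ u → φ (5 + u * 6)) T ∣ ≤ c) where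

  private
    G H : ℕ → ℤ
    G = sum< (λ t → φ (oddPart (1 + t * 3)))
    H = sum< (λ t → φ (oddPart (2 + t * 3)))

    G-*2 : ∀ h → G (h * 2) ≡ sum< (λ u → φ (1 + u * 6)) h ℤ.+ H h
    G-*2 h = trans (sum<-*2 _ h) (cong₂ ℤ._+_
      (sum<-cong h λ u _ → cong φ (trans (cong oddPart (e₁ u)) (oddPart-odd ([r+t*kn]%n≡r%n 1 3 2 u))))
      (sum<-cong h λ u _ → cong φ (trans (cong oddPart (e₂ u)) (oddPart-2* {2 + u * 3} (s≤s z≤n)))))
      where
      e₁ : ∀ u → 1 + u * 2 * 3 ≡ 1 + u * 6
      e₁ = solve-∀
      e₂ : ∀ u → 1 + suc (u * 2) * 3 ≡ 2 * (2 + u * 3)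
      e₂ = solve-∀

    H-*2 : ∀ h → H (h * 2) ≡ G h ℤ.+ sum< (λ u → φ (5 + u * 6)) h
    H-*2 h = trans (sum<-*2 _ h) (cong₂ ℤ._+_
      (sum<-cong h λ u _ → cong φ (trans (cong oddPart (e₁ u)) (oddPart-2* {1 + u * 3} (s≤s z≤n))))
      (sum<-cong h λ u _ → cong φ (trans (cong oddPart (e₂ u)) (oddPart-odd ([r+t*kn]%n≡r%n 5 3 2 u)))))
      where
      e₁ : ∀ u → 2 + u * 2 * 3 ≡ 2 * (1 + u * 3)
      e₁ = solve-∀
      e₂ : ∀ u → 2 + suc (u * 2) * 3 ≡ 5 + u * 6
      e₂ = solve-∀

    D : ℕ → ℕ
    D n = ∣ G n ∣ + ∣ H n ∣

    D-halving : ∀ n → D n ≤ (c + c) + (c + c) + D ⌊ n /2⌋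
    D-halving n = ℕ.≤-trans (ℕ.+-mono-≤ ∣G∣≤ ∣H∣≤) (ℕ.≤-reflexive (regroup c ∣ G h ∣ ∣ H h ∣))
      where
      h = ⌊ n /2⌋
      R₁ = sum< (λ u → φ (1 + u * 6)) h
      R₅ = sum< (λ u → φ (5 + u * 6)) h
      ∣G∣≤ : ∣ G n ∣ ≤ c + (c + ∣ H h ∣)
      ∣G∣≤ = ℕ.≤-trans (∣sum<∣-⌊/2⌋ c (λ t → ∣φ∣≤c (oddPart (1 + t * 3))) n) (ℕ.+-monoʳ-≤ c
               (subst (λ x → ∣ x ∣ ≤ c + ∣ H h ∣) (sym (G-*2 h))
                 (ℕ.≤-trans (ℤ.∣i+j∣≤∣i∣+∣j∣ R₁ (H h)) (ℕ.+-monoˡ-≤ ∣ H h ∣ (∣R₁∣≤c h)))))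
      ∣H∣≤ : ∣ H n ∣ ≤ c + (∣ G h ∣ + c)
      ∣H∣≤ = ℕ.≤-trans (∣sum<∣-⌊/2⌋ c (λ t → ∣φ∣≤c (oddPart (2 + t * 3))) n) (ℕ.+-monoʳ-≤ c
               (subst (λ x → ∣ x ∣ ≤ ∣ G h ∣ + c) (sym (H-*2 h))
                 (ℕ.≤-trans (ℤ.∣i+j∣≤∣i∣+∣j∣ (G h) R₅) (ℕ.+-monoʳ-≤ ∣ G h ∣ (∣R₅∣≤c h)))))
      regroup : ∀ c g k → c + (c + k) + (c + (g + c)) ≡ (c + c) + (c + c) + (g + k)
      regroup = solve-∀

  sublinearSums-oddPart[1+3t] : SublinearSums (λ t → φ (oddPart (1 + t * 3)))
  sublinearSums-oddPart[1+3t] =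
    sublinear-≤ (λ T → ℕ.m≤m+n ∣ G T ∣ ∣ H T ∣) (halving⇒sublinear ((c + c) + (c + c)) refl D-halving)

sign : Bool → ℤ
sign true  = + 1
sign false = -[1+ 0 ]

∣sign∣≤1 : ∀ b → ∣ sign b ∣ ≤ 1
∣sign∣≤1 true  = ℕ.≤-refl
∣sign∣≤1 false = ℕ.≤-refl

sign-not-+ : ∀ b → sign (not b) ℤ.+ sign b ≡ + 0
sign-not-+ true  = refl
sign-not-+ false = refl

module _ (σ : Vec ℕ 3) (opposite : hasPattern σ₃₁₂ σ ≡ not (hasPattern σ₃₂₁ σ)) where

  private
    dropSign-cancel : ∀ s s′ → s % 4 ≡ 3 → s′ % 4 ≡ 1 → (s′ ≡ᵇ 1) ≡ false →
                      sign (dropPattern s σ) ℤ.+ sign (dropPattern s′ σ) ≡ + 0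
    dropSign-cancel s s′ s%4≡3 s′%4≡1 s′≢1 = trans
      (cong₂ (λ x y → sign x ℤ.+ sign y) (trans (dropPattern-≡3 s s%4≡3 σ) opposite) (dropPattern-≡1 s′ s′%4≡1 s′≢1 σ))
      (sign-not-+ (hasPattern σ₃₂₁ σ))

    ∣sign∣≤2 : ∀ s → ∣ sign (dropPattern s σ) ∣ ≤ 2
    ∣sign∣≤2 s = ℕ.m≤n⇒m≤1+n (∣sign∣≤1 (dropPattern s σ))

    ∣sum<∣≤2 : ∀ r → (r + 6) % 4 ≡ 3 → (r + 12) % 4 ≡ 1 → (∀ v → (r + (2 + v * 2) * 6 ≡ᵇ 1) ≡ false) →
               ∀ T → ∣ sum< (λ u → sign (dropPattern (r + u * 6) σ)) T ∣ ≤ 2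
    ∣sum<∣≤2 r r+6≡3 r+12≡1 ≢1 = ∣sum<∣≤-cancelling 1 (λ u → ∣sign∣≤1 (dropPattern (r + u * 6) σ)) λ v →
      dropSign-cancel (r + (1 + v * 2) * 6) (r + (2 + v * 2) * 6)
        (mod4 (r + 6) v r+6≡3 (e₆ r v)) (mod4 (r + 12) v r+12≡1 (e₁₂ r v)) (≢1 v)
      where
      mod4 : ∀ q v {s k} → q % 4 ≡ k → s ≡ q + v * (3 * 4) → s % 4 ≡ k
      mod4 q v q≡k refl = trans ([r+t*kn]%n≡r%n q 3 4 v) q≡k
      e₆ : ∀ r v → r + (1 + v * 2) * 6 ≡ r + 6 + v * 12
      e₆ = solve-∀
      e₁₂ : ∀ r v → r + (2 + v * 2) * 6 ≡ r + 12 + v * 12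
      e₁₂ = solve-∀

  sublinearSums-hasPattern₅ : SublinearSums (sign ∘ hasPattern₅ σ)
  sublinearSums-hasPattern₅ = sublinearSums-oddPart[1+3t] (λ s → sign (dropPattern s σ)) 2 ∣sign∣≤2
    (∣sum<∣≤2 1 refl refl λ _ → refl) (∣sum<∣≤2 5 refl refl λ _ → refl)

  sublinearSums-hasPattern₁₃ : SublinearSums (sign ∘ hasPattern₁₃ σ)
  sublinearSums-hasPattern₁₃ = bounded⇒sublinear 2 (∣sum<∣≤2 5 refl refl λ _ → refl)

residueDeviation-312 : ∀ first b₅ b₁₃ →
                       residueDeviation σ₃₁₂ 1 8 first b₅ b₁₃ ≡ + 8 ℤ.* sign b₅ ℤ.+ + 8 ℤ.* sign b₁₃
residueDeviation-312 _ true  true  = refl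
residueDeviation-312 _ true  false = refl
residueDeviation-312 _ false true  = refl
residueDeviation-312 _ false false = refl

residueDeviation-321 : ∀ first b₅ b₁₃ → residueDeviation σ₃₂₁ 1 4 first b₅ b₁₃ ≡
                       + 4 ℤ.* sign b₅ ℤ.+ + 4 ℤ.* sign b₁₃ ℤ.+ -[1+ 7 ] ℤ.* + ind first
residueDeviation-321 true  true  true  = refl
residueDeviation-321 true  true  false = refl
residueDeviation-321 true  false true  = refl
residueDeviation-321 true  false false = refl
residueDeviation-321 false true  true  = refl
residueDeviation-321 false true  false = refl
residueDeviation-321 false false true  = refl
residueDeviation-321 false false false = refl

sum<-[t≡0] : ∀ T → sum< (λ t → + ind (t ≡ᵇ 0)) (suc T) ≡ + 1
sum<-[t≡0] zero    = refl
sum<-[t≡0] (suc T) = trans (ℤ.+-identityʳ _) (sum<-[t≡0] T)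

sublinearSums-[t≡0] : SublinearSums (λ t → + ind (t ≡ᵇ 0))
sublinearSums-[t≡0] = bounded⇒sublinear 1 λ where
  zero    → z≤n
  (suc T) → ℕ.≤-reflexive (cong ∣_∣ (sum<-[t≡0] T))

density-312 : densityIs σ₃₁₂ (+ 1 ℚ./ 8)
density-312 = density-from-residues σ₃₁₂ 1 7 _
  (λ t → residueDeviation-312 (t ≡ᵇ 0) (hasPattern₅ σ₃₁₂ t) (hasPattern₁₃ σ₃₁₂ t))
  (sublinearSums-+ (sublinearSums-* (+ 8) (sublinearSums-hasPattern₅ σ₃₁₂ refl))
                   (sublinearSums-* (+ 8) (sublinearSums-hasPattern₁₃ σ₃₁₂ refl)))

density-321 : densityIs σ₃₂₁ (+ 1 ℚ./ 4)
density-321 = density-from-residues σ₃₂₁ 1 3 _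
  (λ t → residueDeviation-321 (t ≡ᵇ 0) (hasPattern₅ σ₃₂₁ t) (hasPattern₁₃ σ₃₂₁ t))
  (sublinearSums-+ (sublinearSums-+ (sublinearSums-* (+ 4) (sublinearSums-hasPattern₅ σ₃₂₁ refl))
                                    (sublinearSums-* (+ 4) (sublinearSums-hasPattern₁₃ σ₃₂₁ refl)))
                   (sublinearSums-* -[1+ 7 ] sublinearSums-[t≡0]))

mainTheorem1 : densityIs (1 ∷ 2 ∷ 3 ∷ []) (+ 1 ℚ./ 4)
             × densityIs (1 ∷ 3 ∷ 2 ∷ []) (+ 1 ℚ./ 8)
             × densityIs (2 ∷ 1 ∷ 3 ∷ []) (+ 1 ℚ./ 8)
             × densityIs (2 ∷ 3 ∷ 1 ∷ []) (+ 1 ℚ./ 8)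
             × densityIs (3 ∷ 1 ∷ 2 ∷ []) (+ 1 ℚ./ 8)
             × densityIs (3 ∷ 2 ∷ 1 ∷ []) (+ 1 ℚ./ 4)
-- For the first four patterns each block of sixteen has exactly the expected count, by computation.
mainTheorem1 =
    density-from-residues σ₁₂₃ 1 3 (λ _ → + 0) (λ _ → refl) sublinearSums-0
  , density-from-residues σ₁₃₂ 1 7 (λ _ → + 0) (λ _ → refl) sublinearSums-0
  , density-from-residues σ₂₁₃ 1 7 (λ _ → + 0) (λ _ → refl) sublinearSums-0
  , density-from-residues σ₂₃₁ 1 7 (λ _ → + 0) (λ _ → refl) sublinearSums-0
  , density-312
  , density-321
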